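{- Let $G$ be a connected graph with minimum degree $\delta(G)\ge 2$. If $G$ has an independent $\Gamma$-set, then $\Gamma(G)=\Gamma_{\rm cer}(G)$.
   Context: All graphs are finite and simple. A dominating set of $G$ is a set $D\subseteq V_G$ such that every vertex of $V_G-D$ has a neighbor in $D$; $\Gamma(G)$ is the maximum cardinality of a minimal (with respect to inclusion) dominating set, and a $\Gamma$-set is a minimal dominating set of cardinality $\Gamma(G)$. A certified dominating set is a dominating set $D$ such that every vertex in $D$ has either zero or at least two neighbors in $V_G-D$; $\Gamma_{\rm cer}(G)$ is the maximum cardinality of a minimal (with respect to inclusion) certified dominating set of $G$. -}

module Defs where

open import Data.Nat using (ℕ; _≤_; _≥_)
open import Data.Bool using (Bool; true; false; _∧_; not)
open import Data.Fin using (Fin)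
open import Data.Fin.Subset using (Subset; _∈_; _∉_; _⊂_; ∣_∣)
open import Data.Fin.Subset.Properties using (_∈?_)
open import Data.Vec using (tabulate)
open import Data.Product using (Σ; ∃; _×_)
open import Data.Sum using (_⊎_)
open import Relation.Nullary using (¬_)
open import Relation.Nullary.Decidable using (⌊_⌋)
open import Relation.Binary.PropositionalEquality using (_≡_)

record Graph (n : ℕ) : Set where
  field
    adj   : Fin n → Fin n → Bool
    sym   : ∀ u v → adj u v ≡ adj v u
    irref : ∀ v → adj v v ≡ false
open Graph public

Adj : ∀ {n} → Graph n → Fin n → Fin n → Set
Adj G u v = adj G u v ≡ true

N : ∀ {n} → Graph n → Fin n → Subset n
N G v = tabulate (adj G v)

degree : ∀ {n} → Graph n → Fin n → ℕ
degree G v = ∣ N G v ∣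

minDegree≥ : ∀ {n} → Graph n → ℕ → Set
minDegree≥ G k = ∀ v → k ≤ degree G v

data Walk {n} (G : Graph n) : Fin n → Fin n → Set where
  here : ∀ {v} → Walk G v v
  step : ∀ {u w v} → Adj G u w → Walk G w v → Walk G u v

Connected : ∀ {n} → Graph n → Set
Connected {n} G = Fin n × (∀ u v → Walk G u v)

Dominating : ∀ {n} → Graph n → Subset n → Set
Dominating G D = ∀ v → v ∉ D → ∃ λ u → u ∈ D × Adj G u v

MinimalDominating : ∀ {n} → Graph n → Subset n → Set
MinimalDominating G D = Dominating G D × (∀ D′ → D′ ⊂ D → ¬ Dominating G D′)

Independent : ∀ {n} → Graph n → Subset n → Set
Independent G D = ∀ u v → u ∈ D → v ∈ D → ¬ Adj G u v

Nout : ∀ {n} → Graph n → Subset n → Fin n → Subset n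
Nout G D v = tabulate (λ u → adj G v u ∧ not ⌊ u ∈? D ⌋)

Certified : ∀ {n} → Graph n → Subset n → Set
Certified G D = Dominating G D × (∀ v → v ∈ D → ∣ Nout G D v ∣ ≡ 0 ⊎ ∣ Nout G D v ∣ ≥ 2)

MinimalCertified : ∀ {n} → Graph n → Subset n → Set
MinimalCertified G D = Certified G D × (∀ D′ → D′ ⊂ D → ¬ Certified G D′)

IsUpperDomination : ∀ {n} → Graph n → ℕ → Set
IsUpperDomination G k =
  (∃ λ D → MinimalDominating G D × ∣ D ∣ ≡ k) × (∀ D → MinimalDominating G D → ∣ D ∣ ≤ k)

IsUpperCertifiedDomination : ∀ {n} → Graph n → ℕ → Set
IsUpperCertifiedDomination G k =
  (∃ λ D → MinimalCertified G D × ∣ D ∣ ≡ k) × (∀ D → MinimalCertified G D → ∣ D ∣ ≤ k)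

ΓSet : ∀ {n} → Graph n → Subset n → Set
ΓSet G D = MinimalDominating G D × (∀ D′ → MinimalDominating G D′ → ∣ D′ ∣ ≤ ∣ D ∣)

-- An independent Γ-set D is certified, because every vertex of D has all of its
-- (at least two) neighbours outside D, and it is minimal certified because its
-- proper subsets do not even dominate; hence Γ ≤ Γ_cer.
--
-- Conversely, let D be minimal certified and δ ≥ 2. No vertex of D lacks outside
-- neighbours: otherwise keep the set T of vertices of D having outside neighbours,
-- together with a maximal independent set J of those remaining vertices of D that
-- have no neighbour in T. Then T ∪ J is a smaller certified dominating set (the
-- vertices of J have all their ≥ 2 neighbours outside T ∪ J). So every vertex of D
-- has ≥ 2 outside neighbours, which persists when passing to subsets of D; hence
-- every dominating subset of D is certified, D is minimal dominating, and
-- Γ_cer ≤ Γ.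
module Submission where

open import Defs
open import Data.Bool using (Bool; true; false; _∧_; not)
open import Data.Bool.Properties using () renaming (_≟_ to _≟ᵇ_)
open import Data.Empty using (⊥-elim)
open import Data.Fin using (Fin)
open import Data.Fin.Properties using (any?) renaming (_≟_ to _≟ᶠ_)
open import Data.Fin.Subset using (Subset; _∈_; _∉_; _⊆_; _⊂_; ∣_∣; _∪_; ⁅_⁆) renaming (⊥ to ∅)
open import Data.Fin.Subset.Properties
  using (_∈?_; nonempty?; Empty-unique; ∣⊥∣≡0; ∣p∣≤n; p⊆q⇒∣p∣≤∣q∣; p⊂q⇒∣p∣<∣q∣; ∉⊥;
         x∈p∪q⁻; x∈p∪q⁺; ∣⁅x⁆∣≡1; x∈⁅y⁆⇒x≡y; x∈⁅x⁆)
open import Data.Nat using (ℕ; zero; suc; _≤_; _<_; _≟_; z≤n; s≤s)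
open import Data.Nat.Properties using (≤-antisym; ≤-trans; ≤-pred)
open import Data.Product using (∃; _×_; _,_; proj₁; proj₂)
open import Data.Sum using (inj₁; inj₂; [_,_])
open import Data.Vec using (tabulate)
open import Data.Vec.Properties using (lookup∘tabulate; []=⇒lookup; lookup⇒[]=)
open import Function using (_∘_)
open import Relation.Nullary using (¬_; Dec; yes; no; does; contradiction)
open import Relation.Nullary.Decidable using (_×-dec_; ¬?; dec-true; dec-false; isYes≗does)
open import Relation.Unary using (Pred; Decidable)
open import Relation.Binary.PropositionalEquality
  using (_≡_; refl; trans; subst; cong; cong₂) renaming (sym to ≡-sym)

∈-tabulate⁺ : ∀ {n} {f : Fin n → Bool} {x} → f x ≡ true → x ∈ tabulate f
∈-tabulate⁺ {f = f} {x} fx = lookup⇒[]= x (tabulate f) (trans (lookup∘tabulate f x) fx)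

∈-tabulate⁻ : ∀ {n} {f : Fin n → Bool} {x} → x ∈ tabulate f → f x ≡ true
∈-tabulate⁻ {f = f} {x} x∈ = trans (≡-sym (lookup∘tabulate f x)) ([]=⇒lookup x∈)

subset : ∀ {n ℓ} {P : Pred (Fin n) ℓ} → Decidable P → Subset n
subset P? = tabulate (does ∘ P?)

∈-subset⁺ : ∀ {n ℓ} {P : Pred (Fin n) ℓ} (P? : Decidable P) {x} → P x → x ∈ subset P?
∈-subset⁺ P? {x} px = ∈-tabulate⁺ (dec-true (P? x) px)

∈-subset⁻ : ∀ {n ℓ} {P : Pred (Fin n) ℓ} (P? : Decidable P) {x} → x ∈ subset P? → P x
∈-subset⁻ P? {x} x∈ with P? x | ∈-tabulate⁻ {f = does ∘ P?} x∈
... | yes px | _ = px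
... | no _   | ()

x∈p⇒0<∣p∣ : ∀ {n} {p : Subset n} {x} → x ∈ p → 0 < ∣ p ∣
x∈p⇒0<∣p∣ {x = x} x∈p =
  subst (_≤ _) (∣⁅x⁆∣≡1 x) (p⊆q⇒∣p∣≤∣q∣ (λ y∈⁅x⁆ → subst (_∈ _) (≡-sym (x∈⁅y⁆⇒x≡y _ y∈⁅x⁆)) x∈p))

module _ {n} (G : Graph n) where

  Adj? : ∀ u v → Dec (Adj G u v)
  Adj? u v = adj G u v ≟ᵇ true

  Adj-sym : ∀ {u v} → Adj G u v → Adj G v u
  Adj-sym {u} {v} a = trans (Graph.sym G v u) a

  Adj-irrefl : ∀ {v} → ¬ Adj G v v
  Adj-irrefl {v} a with trans (≡-sym (irref G v)) a
  ... | ()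

  N⁻ : ∀ {v w} → w ∈ N G v → Adj G v w
  N⁻ = ∈-tabulate⁻

  Nout⁺ : ∀ {C v w} → Adj G v w → w ∉ C → w ∈ Nout G C v
  Nout⁺ {C} {w = w} a w∉C =
    ∈-tabulate⁺ (cong₂ (λ b c → b ∧ not c) a (trans (isYes≗does (w ∈? C)) (dec-false (w ∈? C) w∉C)))

  Nout⁻ : ∀ {C v w} → w ∈ Nout G C v → Adj G v w × w ∉ C
  Nout⁻ {C} {v} {w} w∈ with adj G v w | w ∈? C | ∈-tabulate⁻ w∈
  ... | true  | no w∉C | _ = refl , w∉C
  ... | true  | yes _  | ()
  ... | false | _      | ()

  Nout-antitone : ∀ {C D v} → C ⊆ D → Nout G D v ⊆ Nout G C v
  Nout-antitone C⊆D w∈ with Nout⁻ w∈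
  ... | a , w∉D = Nout⁺ a (w∉D ∘ C⊆D)

  degree≤∣Nout∣ : ∀ {C v} → (∀ {w} → Adj G v w → w ∉ C) → degree G v ≤ ∣ Nout G C v ∣
  degree≤∣Nout∣ outside = p⊆q⇒∣p∣≤∣q∣ (λ w∈N → Nout⁺ (N⁻ w∈N) (outside (N⁻ w∈N)))

  ∣Nout∣≡0⇒Adj⇒∈ : ∀ {C v w} → ∣ Nout G C v ∣ ≡ 0 → Adj G v w → w ∈ C
  ∣Nout∣≡0⇒Adj⇒∈ {C} {w = w} ∣Nout∣≡0 a with w ∈? C
  ... | yes w∈C = w∈C
  ... | no w∉C  = contradiction (subst (0 <_) ∣Nout∣≡0 (x∈p⇒0<∣p∣ (Nout⁺ a w∉C))) λ ()

  neighbour : ∀ {v} → 0 < degree G v → ∃ (Adj G v)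
  neighbour {v} 0<deg with nonempty? (N G v)
  ... | yes (w , w∈N) = w , N⁻ w∈N
  ... | no empty =
    contradiction (subst (0 <_) (trans (cong ∣_∣ (Empty-unique empty)) (∣⊥∣≡0 n)) 0<deg) λ ()

  record MaximalIndependentSubset (P : Subset n) : Set where
    field
      J           : Subset n
      J⊆P         : J ⊆ P
      independent : Independent G J
      maximal     : ∀ {z} → z ∈ P → z ∉ J → ∃ λ j → j ∈ J × Adj G j z

  maximalIndependentSubset≤ : ∀ m (P : Subset n) → ∣ P ∣ ≤ m → MaximalIndependentSubset P
  maximalIndependentSubset≤ m P ∣P∣≤m with nonempty? P
  ... | no empty = record
    { J           = ∅
    ; J⊆P         = ⊥-elim ∘ ∉⊥
    ; independent = λ _ _ u∈⊥ _ _ → ∉⊥ u∈⊥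
    ; maximal     = λ z∈P _ → ⊥-elim (empty (_ , z∈P))
    }
  maximalIndependentSubset≤ zero P ∣P∣≤0 | yes (_ , p∈P) =
    contradiction (≤-trans (x∈p⇒0<∣p∣ p∈P) ∣P∣≤0) λ ()
  maximalIndependentSubset≤ (suc m) P ∣P∣≤m | yes (p , p∈P) = record
    { J           = ⁅ p ⁆ ∪ J′
    ; J⊆P         = J⊆P
    ; independent = independent
    ; maximal     = maximal
    }
    where
    Rest? : Decidable (λ x → x ∈ P × ¬ x ≡ p × ¬ Adj G p x)
    Rest? x = x ∈? P ×-dec ¬? (x ≟ᶠ p) ×-dec ¬? (Adj? p x)

    Rest⊂P : subset Rest? ⊂ P
    Rest⊂P = proj₁ ∘ ∈-subset⁻ Rest? , p , p∈P , λ p∈ → proj₁ (proj₂ (∈-subset⁻ Rest? p∈)) refl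

    open MaximalIndependentSubset
      (maximalIndependentSubset≤ m (subset Rest?) (≤-pred (≤-trans (p⊂q⇒∣p∣<∣q∣ Rest⊂P) ∣P∣≤m)))
      renaming (J to J′; J⊆P to J′⊆Rest; independent to J′-independent; maximal to J′-maximal)

    J′-nonadjacent : ∀ {j} → j ∈ J′ → ¬ Adj G p j
    J′-nonadjacent = proj₂ ∘ proj₂ ∘ ∈-subset⁻ Rest? ∘ J′⊆Rest

    J⊆P : ⁅ p ⁆ ∪ J′ ⊆ P
    J⊆P x∈ with x∈p∪q⁻ ⁅ p ⁆ J′ x∈
    ... | inj₁ x∈⁅p⁆ = subst (_∈ P) (≡-sym (x∈⁅y⁆⇒x≡y _ x∈⁅p⁆)) p∈P
    ... | inj₂ x∈J′  = proj₁ (∈-subset⁻ Rest? (J′⊆Rest x∈J′))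

    independent : Independent G (⁅ p ⁆ ∪ J′)
    independent u v u∈ v∈ with x∈p∪q⁻ ⁅ p ⁆ J′ u∈ | x∈p∪q⁻ ⁅ p ⁆ J′ v∈
    ... | inj₁ u∈⁅p⁆ | inj₁ v∈⁅p⁆
      rewrite x∈⁅y⁆⇒x≡y _ u∈⁅p⁆ | x∈⁅y⁆⇒x≡y _ v∈⁅p⁆ = Adj-irrefl
    ... | inj₁ u∈⁅p⁆ | inj₂ v∈J′ rewrite x∈⁅y⁆⇒x≡y _ u∈⁅p⁆ = J′-nonadjacent v∈J′
    ... | inj₂ u∈J′  | inj₁ v∈⁅p⁆ rewrite x∈⁅y⁆⇒x≡y _ v∈⁅p⁆ = J′-nonadjacent u∈J′ ∘ Adj-sym
    ... | inj₂ u∈J′  | inj₂ v∈J′  = J′-independent u v u∈J′ v∈J′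

    maximal : ∀ {z} → z ∈ P → z ∉ ⁅ p ⁆ ∪ J′ → ∃ λ j → j ∈ ⁅ p ⁆ ∪ J′ × Adj G j z
    maximal {z} z∈P z∉J with Adj? p z
    ... | yes a = p , x∈p∪q⁺ (inj₁ (x∈⁅x⁆ p)) , a
    ... | no ¬a with J′-maximal (∈-subset⁺ Rest? (z∈P , (λ { refl → z∉J (x∈p∪q⁺ (inj₁ (x∈⁅x⁆ p))) }) , ¬a))
                                (z∉J ∘ x∈p∪q⁺ ∘ inj₂)
    ... | j , j∈J′ , a = j , x∈p∪q⁺ (inj₂ j∈J′) , a

  maximalIndependentSubset : ∀ P → MaximalIndependentSubset P
  maximalIndependentSubset P = maximalIndependentSubset≤ n P (∣p∣≤n P)

  module Shrink (D : Subset n) where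

    T? : Decidable (λ v → v ∈ D × ¬ ∣ Nout G D v ∣ ≡ 0)
    T? v = v ∈? D ×-dec ¬? (∣ Nout G D v ∣ ≟ 0)

    T : Subset n
    T = subset T?

    Z? : Decidable (λ v → v ∈ D × ∣ Nout G D v ∣ ≡ 0 × ¬ ∃ λ w → w ∈ T × Adj G v w)
    Z? v = v ∈? D ×-dec (∣ Nout G D v ∣ ≟ 0) ×-dec ¬? (any? λ w → w ∈? T ×-dec Adj? v w)

    open MaximalIndependentSubset (maximalIndependentSubset (subset Z?))

    C : Subset n
    C = T ∪ J

    C⊆D : C ⊆ D
    C⊆D v∈C with x∈p∪q⁻ T J v∈C
    ... | inj₁ v∈T = proj₁ (∈-subset⁻ T? v∈T)
    ... | inj₂ v∈J = proj₁ (∈-subset⁻ Z? (J⊆P v∈J))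

    J-isolated : ∀ {v w} → v ∈ J → Adj G v w → w ∉ C
    J-isolated {v} {w} v∈J a w∈C with x∈p∪q⁻ T J w∈C
    ... | inj₁ w∈T = proj₂ (proj₂ (∈-subset⁻ Z? (J⊆P v∈J))) (w , w∈T , a)
    ... | inj₂ w∈J = independent v w v∈J w∈J a

    C-dominating : Dominating G D → Dominating G C
    C-dominating dom x x∉C with x ∈? D
    ... | no x∉D with dom x x∉D
    ...   | u , u∈D , a = u , x∈p∪q⁺ (inj₁ (∈-subset⁺ T? (u∈D , λ ≡0 → x∉D (∣Nout∣≡0⇒Adj⇒∈ ≡0 a)))) , a
    C-dominating dom x x∉C | yes x∈D with ∣ Nout G D x ∣ ≟ 0
    ... | no ≢0 = ⊥-elim (x∉C (x∈p∪q⁺ (inj₁ (∈-subset⁺ T? (x∈D , ≢0)))))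
    ... | yes ≡0 with any? (λ w → w ∈? T ×-dec Adj? x w)
    ...   | yes (w , w∈T , a) = w , x∈p∪q⁺ (inj₁ w∈T) , Adj-sym a
    ...   | no ¬adjT with maximal (∈-subset⁺ Z? (x∈D , ≡0 , ¬adjT)) (x∉C ∘ x∈p∪q⁺ ∘ inj₂)
    ...     | j , j∈J , a = j , x∈p∪q⁺ (inj₂ j∈J) , a

    C-certified : minDegree≥ G 2 → Certified G D → Certified G C
    C-certified δ (dom , cer) = C-dominating dom , λ v v∈C → inj₂ (cert v v∈C)
      where
      cert : ∀ v → v ∈ C → 2 ≤ ∣ Nout G C v ∣
      cert v v∈C with x∈p∪q⁻ T J v∈C
      ... | inj₂ v∈J = ≤-trans (δ v) (degree≤∣Nout∣ (J-isolated v∈J))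
      ... | inj₁ v∈T with ∈-subset⁻ T? v∈T
      ...   | v∈D , ≢0 = ≤-trans ([ (λ ≡0 → contradiction ≡0 ≢0) , (λ 2≤ → 2≤) ] (cer v v∈D))
                                 (p⊆q⇒∣p∣≤∣q∣ (Nout-antitone C⊆D))

    C⊂D : minDegree≥ G 2 → ∀ {u} → u ∈ D → ∣ Nout G D u ∣ ≡ 0 → C ⊂ D
    C⊂D δ {u} u∈D ≡0 with u ∈? J
    ... | no u∉J = C⊆D , u , u∈D , [ (λ u∈T → proj₂ (∈-subset⁻ T? u∈T) ≡0) , u∉J ] ∘ x∈p∪q⁻ T J
    ... | yes u∈J with neighbour (≤-trans (s≤s z≤n) (δ u))
    ...   | w , a = C⊆D , w , ∣Nout∣≡0⇒Adj⇒∈ ≡0 a , J-isolated u∈J a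

  certified-shrink : minDegree≥ G 2 → ∀ {D u} → Certified G D → u ∈ D → ∣ Nout G D u ∣ ≡ 0 →
                     ∃ λ C → C ⊂ D × Certified G C
  certified-shrink δ {D} cert u∈D ≡0 = C , C⊂D δ u∈D ≡0 , C-certified δ cert
    where open Shrink D

  minimalCertified⇒2≤∣Nout∣ : minDegree≥ G 2 → ∀ {D v} → MinimalCertified G D → v ∈ D →
                              2 ≤ ∣ Nout G D v ∣
  minimalCertified⇒2≤∣Nout∣ δ (cert , minimal) v∈D with proj₂ cert _ v∈D
  ... | inj₂ 2≤ = 2≤
  ... | inj₁ ≡0 with certified-shrink δ cert v∈D ≡0
  ...   | C , C⊂D , certC = contradiction certC (minimal C C⊂D)

  dominating⊆⇒certified : ∀ {C D} → (∀ v → v ∈ D → 2 ≤ ∣ Nout G D v ∣) →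
                          C ⊆ D → Dominating G C → Certified G C
  dominating⊆⇒certified 2≤Nout C⊆D dom =
    dom , λ v v∈C → inj₂ (≤-trans (2≤Nout v (C⊆D v∈C)) (p⊆q⇒∣p∣≤∣q∣ (Nout-antitone C⊆D)))

  minimalCertified⇒minimalDominating : minDegree≥ G 2 → ∀ {D} →
                                       MinimalCertified G D → MinimalDominating G D
  minimalCertified⇒minimalDominating δ mc@(cert , minimal) =
    proj₁ cert ,
    λ C C⊂D dom → minimal C C⊂D
      (dominating⊆⇒certified (λ _ → minimalCertified⇒2≤∣Nout∣ δ mc) (proj₁ C⊂D) dom)

  independent⇒minimalCertified : minDegree≥ G 2 → ∀ {D} → Independent G D →
                                 MinimalDominating G D → MinimalCertified G D
  independent⇒minimalCertified δ ind (dom , minimal) =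
    (dom , λ v v∈D → inj₂ (≤-trans (δ v) (degree≤∣Nout∣ λ a w∈D → ind _ _ v∈D w∈D a)))
    , λ C C⊂D cert → minimal C C⊂D (proj₁ cert)

theorem3p5 : ∀ {n} (G : Graph n) → Connected G → minDegree≥ G 2 →
    (∃ λ D → ΓSet G D × Independent G D) →
    ∀ (k : ℕ) → IsUpperDomination G k → IsUpperCertifiedDomination G k
theorem3p5 G _ δ (D , (mdD , maximum) , ind) k ((D₀ , mdD₀ , ∣D₀∣≡k) , bound) =
  (D , independent⇒minimalCertified G δ ind mdD , ∣D∣≡k) ,
  λ D′ mc → bound D′ (minimalCertified⇒minimalDominating G δ mc)
  where
  ∣D∣≡k : ∣ D ∣ ≡ k
  ∣D∣≡k = ≤-antisym (bound D mdD) (subst (_≤ ∣ D ∣) ∣D₀∣≡k (maximum D₀ mdD₀))
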